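{- Let $\ell_1,\ell_2$ be positive integers and $m=\ell_1+\ell_2$. Let $\mathcal{F}_1$ be an admissible $[m_1,\ldots,m_s]$-decomposition of $J^*_{2\ell_1}$ and $\mathcal{F}_2$ an admissible $[r_1,\ldots,r_t]$-decomposition of $J^*_{2\ell_2}$. If $\mathcal{F}_1$ and $\mathcal{F}_2$ are compatible with external pattern $(X_1,\ldots,X_9)$, then there exists an admissible $[m_1,\ldots,m_s,r_1,\ldots,r_t]$-decomposition of $J^*_{2m}$ with external pattern $(X_1,\ldots,X_9)$.
   Context: A $2$-regular digraph $[m_1,\ldots,m_t]$ is a vertex-disjoint union of directed cycles of lengths $m_1,\ldots,m_t$ (each $\ge2$; a directed $2$-cycle on $\{u,v\}$ has arcs $uv,vu$); its order is $m_1+\cdots+m_t$. For a graph $G$, $G^*$ replaces each edge $\{u,v\}$ by arcs $uv,vu$. For an integer $\ell\ge1$, $J_{2\ell}$ is the graph with vertex set $\{x_i,y_i : 0\le i\le \ell+1\}$ and edges $\{x_i,y_i\}$ for $1\le i\le \ell$, together with $\{x_i,x_{i+1}\},\{y_i,y_{i+1}\},\{x_i,y_{i+1}\},\{y_i,x_{i+1}\},\{x_i,x_{i+2}\},\{y_i,y_{i+2}\},\{x_i,y_{i+2}\},\{y_i,x_{i+2}\}$ for $0\le i\le \ell-1$ (so $J^*_{2\ell}$ has $18\ell$ arcs). An admissible $2$-regular subdigraph of $J^*_{2\ell}$ is a $2$-regular subdigraph of order $2\ell$ containing exactly one vertex from each of $\{x_0,x_\ell\},\{x_1,x_{\ell+1}\},\{y_0,y_\ell\},\{y_1,y_{\ell+1}\}$;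 its external pattern is $V(F)\cap\{x_0,x_1,y_0,y_1\}$. An admissible $F$-decomposition of $J^*_{2\ell}$ is a list $(F_1,\ldots,F_9)$ of pairwise arc-disjoint admissible $2$-regular subdigraphs, each isomorphic to $F$, whose arc sets partition $A(J^*_{2\ell})$; its external pattern is $(X_1,\ldots,X_9)$ with $X_i$ the external pattern of $F_i$. Two such decompositions $(F_1,\ldots,F_9)$ of $J^*_{2\ell_1}$ and $(F'_1,\ldots,F'_9)$ of $J^*_{2\ell_2}$ are compatible if $F_i$ and $F_i'$ have the same external pattern for every $i$. -}

module Defs where

open import Data.Nat using (ℕ; zero; suc; _+_; _*_; _≤_; _<_)
open import Data.Fin using (Fin; toℕ; fromℕ; inject₁) renaming (zero to fz; suc to fs)
open import Data.Bool using (Bool; true)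
open import Data.List using (List; []; _∷_; _++_; length; map; concat; zip; [_])
open import Data.List.Relation.Unary.All using (All)
open import Data.List.Relation.Unary.Unique.Propositional using (Unique)
open import Data.List.Relation.Binary.Permutation.Propositional using (_↭_)
open import Data.List.Membership.Propositional using (_∈_; _∉_)
open import Data.Product using (Σ; _×_; _,_; ∃)
open import Data.Sum using (_⊎_)
open import Relation.Binary.PropositionalEquality using (_≡_)
open import Function.Bundles using (_⇔_)

-- Vertices of J_{2ℓ}: X i = x_i, Y i = y_i, 0 ≤ i ≤ ℓ+1.
data Side : Set where
  X Y : Side

Vertex : ℕ → Set
Vertex ℓ = Side × Fin (2 + ℓ)

-- Edges of J_{2ℓ} (one orientation listed per edge).
data Adj (ℓ : ℕ) : Vertex ℓ → Vertex ℓ → Set where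
  rung : (i : Fin (2 + ℓ)) → 1 ≤ toℕ i → toℕ i ≤ ℓ → Adj ℓ (X , i) (Y , i)
  step1 : (s t : Side) (i j : Fin (2 + ℓ)) → toℕ i < ℓ → toℕ j ≡ suc (toℕ i) → Adj ℓ (s , i) (t , j)
  step2 : (s t : Side) (i j : Fin (2 + ℓ)) → toℕ i < ℓ → toℕ j ≡ suc (suc (toℕ i)) → Adj ℓ (s , i) (t , j)

JArc : (ℓ : ℕ) → Vertex ℓ → Vertex ℓ → Set
JArc ℓ u v = Adj ℓ u v ⊎ Adj ℓ v u

cycleArcs : {A : Set} → List A → List (A × A)
cycleArcs [] = []
cycleArcs (v ∷ vs) = zip (v ∷ vs) (vs ++ [ v ])

-- A 2-regular digraph presented as a list of vertex-disjoint directed cycles.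
Cycles : ℕ → Set
Cycles ℓ = List (List (Vertex ℓ))

verts : {ℓ : ℕ} → Cycles ℓ → List (Vertex ℓ)
verts = concat

arcs : {ℓ : ℕ} → Cycles ℓ → List (Vertex ℓ × Vertex ℓ)
arcs C = concat (map cycleArcs C)

x₀ x₁ y₀ y₁ xℓ xℓ₁ yℓ yℓ₁ : (ℓ : ℕ) → Vertex ℓ
x₀ ℓ = X , fz
x₁ ℓ = X , fs fz
y₀ ℓ = Y , fz
y₁ ℓ = Y , fs fz
xℓ ℓ = X , inject₁ (fromℕ ℓ)
xℓ₁ ℓ = X , fromℕ (suc ℓ)
yℓ ℓ = Y , inject₁ (fromℕ ℓ)
yℓ₁ ℓ = Y , fromℕ (suc ℓ)

ExactlyOne : {A : Set} → A → A → List A → Set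
ExactlyOne a b V = (a ∈ V × b ∉ V) ⊎ (a ∉ V × b ∈ V)

record AdmissibleCopy (ℓ : ℕ) (ms : List ℕ) (C : Cycles ℓ) : Set where
  field
    cycleLengths : map length C ↭ ms
    cyclesLong   : All (λ c → 2 ≤ length c) C
    disjoint     : Unique (verts C)
    arcsInJ      : All (λ a → JArc ℓ (Data.Product.proj₁ a) (Data.Product.proj₂ a)) (arcs C)
    order        : length (verts C) ≡ 2 * ℓ
    adm-x0       : ExactlyOne (x₀ ℓ) (xℓ ℓ) (verts C)
    adm-x1       : ExactlyOne (x₁ ℓ) (xℓ₁ ℓ) (verts C)
    adm-y0       : ExactlyOne (y₀ ℓ) (yℓ ℓ) (verts C)
    adm-y1       : ExactlyOne (y₁ ℓ) (yℓ₁ ℓ) (verts C)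

record AdmissibleDecomp (ℓ : ℕ) (ms : List ℕ) : Set where
  field
    F        : Fin 9 → Cycles ℓ
    copy     : (i : Fin 9) → AdmissibleCopy ℓ ms (F i)
    arcDisj  : (i j : Fin 9) (u v : Vertex ℓ) → (u , v) ∈ arcs (F i) → (u , v) ∈ arcs (F j) → i ≡ j
    arcCover : (u v : Vertex ℓ) → JArc ℓ u v → ∃ λ i → (u , v) ∈ arcs (F i)

data Ext : Set where
  ex0 ex1 ey0 ey1 : Ext

ext : (ℓ : ℕ) → Ext → Vertex ℓ
ext ℓ ex0 = x₀ ℓ
ext ℓ ex1 = x₁ ℓ
ext ℓ ey0 = y₀ ℓ
ext ℓ ey1 = y₁ ℓ

-- Pattern (X₁,…,X₉) given as characteristic functions Fin 9 → Ext → Bool.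
HasPattern : {ℓ : ℕ} {ms : List ℕ} → AdmissibleDecomp ℓ ms → (Fin 9 → Ext → Bool) → Set
HasPattern {ℓ} D P = (i : Fin 9) (e : Ext) → (ext ℓ e ∈ verts (AdmissibleDecomp.F D i)) ⇔ (P i e ≡ true)

{-# OPTIONS --safe #-}
-- J_{2ℓ₁} and J_{2ℓ₂} embed in J_{2(ℓ₁+ℓ₂)} by i ↦ i and j ↦ ℓ₁ + j. The two images share only the
-- vertices x_{ℓ₁}, x_{ℓ₁+1}, y_{ℓ₁}, y_{ℓ₁+1} (the images of x₀, x₁, y₀, y₁ of the second graph) and no arc,
-- and every arc of the big graph lies in one of them; so gluing F_i to F'_i gives arc-disjoint copies of
-- [m₁,…,m_s,r₁,…,r_t] covering J*_{2(ℓ₁+ℓ₂)}. The halves of a glued copy are vertex-disjoint because the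
-- patterns agree: x₀ ∈ F'_i iff x₀ ∈ F_i iff x_{ℓ₁} ∉ F_i. The glued copy contains x₀ iff F'_i does, and
-- x_{ℓ₁+ℓ₂} iff F'_i contains x_{ℓ₂}, so it inherits admissibility from F'_i. For ℓ = 1 there is no
-- admissible decomposition at all.
module Submission where

open import Defs
open import Data.Nat using (ℕ; zero; suc; _+_; _*_; _≤_; _<_; z≤n; s≤s; z<s; s<s)
open import Data.Nat.Properties
open import Data.Fin using (Fin; toℕ; fromℕ<; cast; _↑ˡ_; _↑ʳ_) renaming (zero to fz; suc to fs)
open import Data.Fin.Properties using (toℕ-injective; toℕ-fromℕ<; toℕ-fromℕ; toℕ-inject₁; toℕ<n; toℕ-↑ˡ; toℕ-↑ʳ; toℕ-cast)
open import Data.Bool using (Bool)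
open import Data.List using (List; []; _∷_; _++_; map; concat; zip; zipWith; length; [_])
open import Data.List.Properties using (map-++; concat-++; concat-map; length-map; length-++; map-∘; map-cong; zipWith-map; map-zipWith)
open import Data.List.Membership.Propositional using (_∈_)
open import Data.List.Membership.Propositional.Properties using (∈-map⁻; ∈-map⁺; ∈-++⁻; ∈-++⁺ˡ; ∈-++⁺ʳ; ∈-concat⁻′; ∈-concat⁺′)
open import Data.List.Relation.Unary.Any using (here; there)
open import Data.List.Relation.Unary.All as All using (All)
import Data.List.Relation.Unary.All.Properties as All
import Data.List.Relation.Unary.Unique.Propositional.Properties as Unique
open import Data.List.Relation.Unary.Unique.Propositional using (Unique)
open import Data.List.Relation.Binary.Disjoint.Propositional using (Disjoint)
import Data.List.Relation.Binary.Permutation.Propositional.Properties as ↭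
open import Data.List.Relation.Binary.Permutation.Propositional using (_↭_)
open import Data.Product as × using (Σ; _×_; _,_; proj₁; proj₂; ∃; ∃₂; uncurry)
open import Data.Sum as ⊎ using (_⊎_; inj₁; inj₂)
open import Data.Empty using (⊥; ⊥-elim)
open import Function using (_∘_; flip)
open import Function.Bundles using (_⇔_; mk⇔; Equivalence)
open import Function.Construct.Composition using (_⇔-∘_)
open import Function.Construct.Symmetry using (⇔-sym)
open import Function.Definitions using (Injective)
open import Relation.Nullary using (¬_)
open import Relation.Binary.PropositionalEquality hiding ([_])

mapArc : {A B : Set} → (A → B) → A × A → B × B
mapArc f = ×.map f f

module _ {A B : Set} (f : A → B) where

  cycleArcs-map : (c : List A) → cycleArcs (map f c) ≡ map (mapArc f) (cycleArcs c)
  cycleArcs-map []       = refl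
  cycleArcs-map (v ∷ vs) = begin
    zip (map f (v ∷ vs)) (map f vs ++ [ f v ])         ≡⟨ cong (zip _) (map-++ f vs [ v ]) ⟨
    zip (map f (v ∷ vs)) (map f (vs ++ [ v ]))         ≡⟨ zipWith-map _,_ f f (v ∷ vs) (vs ++ [ v ]) ⟩
    zipWith (λ x y → f x , f y) (v ∷ vs) (vs ++ [ v ]) ≡⟨ map-zipWith _,_ (mapArc f) (v ∷ vs) (vs ++ [ v ]) ⟨
    map (mapArc f) (zip (v ∷ vs) (vs ++ [ v ]))        ∎
    where open ≡-Reasoning

  arcs-map : (C : List (List A)) →
    concat (map cycleArcs (map (map f) C)) ≡ map (mapArc f) (concat (map cycleArcs C))
  arcs-map C = begin
    concat (map cycleArcs (map (map f) C))         ≡⟨ cong concat (sym (map-∘ C)) ⟩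
    concat (map (cycleArcs ∘ map f) C)             ≡⟨ cong concat (map-cong cycleArcs-map C) ⟩
    concat (map (map (mapArc f) ∘ cycleArcs) C)    ≡⟨ cong concat (map-∘ C) ⟩
    concat (map (map (mapArc f)) (map cycleArcs C)) ≡⟨ concat-map (map cycleArcs C) ⟩
    map (mapArc f) (concat (map cycleArcs C))      ∎
    where open ≡-Reasoning

arcs-++ : {A : Set} (C D : List (List A)) →
  concat (map cycleArcs (C ++ D)) ≡ concat (map cycleArcs C) ++ concat (map cycleArcs D)
arcs-++ C D = trans (cong concat (map-++ cycleArcs C D)) (sym (concat-++ (map cycleArcs C) (map cycleArcs D)))

∈-zip⁻ : {A : Set} {a b : A} (xs ys : List A) → (a , b) ∈ zip xs ys → a ∈ xs × b ∈ ys
∈-zip⁻ (x ∷ xs) (y ∷ ys) (here refl) = here refl , here refl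
∈-zip⁻ (x ∷ xs) (y ∷ ys) (there ab∈) = ×.map there there (∈-zip⁻ xs ys ab∈)

∈-cycleArcs⁻ : {A : Set} {a b : A} (c : List A) → (a , b) ∈ cycleArcs c → a ∈ c × b ∈ c
∈-cycleArcs⁻ (v ∷ vs) ab∈ with ∈-zip⁻ (v ∷ vs) (vs ++ [ v ]) ab∈
... | a∈ , b∈ with ∈-++⁻ vs b∈
...   | inj₁ b∈vs        = a∈ , there b∈vs
...   | inj₂ (here refl) = a∈ , here refl

∈-arcs⁻ : {A : Set} {a b : A} (C : List (List A)) →
  (a , b) ∈ concat (map cycleArcs C) → a ∈ concat C × b ∈ concat C
∈-arcs⁻ C ab∈ with ∈-concat⁻′ (map cycleArcs C) ab∈
... | _ , ab∈c , c∈ with ∈-map⁻ cycleArcs c∈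
...   | c , c∈C , refl = ×.map (flip ∈-concat⁺′ c∈C) (flip ∈-concat⁺′ c∈C) (∈-cycleArcs⁻ c ab∈c)

module _ {A B C : Set} (f : A → C) (g : B → C) where

  glue : List (List A) → List (List B) → List (List C)
  glue F G = map (map f) F ++ map (map g) G

  concat-glue : (F : List (List A)) (G : List (List B)) →
    concat (glue F G) ≡ map f (concat F) ++ map g (concat G)
  concat-glue F G = begin
    concat (map (map f) F ++ map (map g) G)           ≡⟨ sym (concat-++ (map (map f) F) _) ⟩
    concat (map (map f) F) ++ concat (map (map g) G) ≡⟨ cong₂ _++_ (concat-map F) (concat-map G) ⟩
    map f (concat F) ++ map g (concat G)             ∎
    where open ≡-Reasoning

  arcs-glue : (F : List (List A)) (G : List (List B)) →
    concat (map cycleArcs (glue F G))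
      ≡ map (mapArc f) (concat (map cycleArcs F)) ++ map (mapArc g) (concat (map cycleArcs G))
  arcs-glue F G = trans (arcs-++ (map (map f) F) _) (cong₂ _++_ (arcs-map f F) (arcs-map g G))

  length-concat-glue : (F : List (List A)) (G : List (List B)) →
    length (concat (glue F G)) ≡ length (concat F) + length (concat G)
  length-concat-glue F G = begin
    length (concat (glue F G))                     ≡⟨ cong length (concat-glue F G) ⟩
    length (map f (concat F) ++ map g (concat G)) ≡⟨ length-++ (map f (concat F)) ⟩
    length (map f (concat F)) + length (map g (concat G))
                                                   ≡⟨ cong₂ _+_ (length-map f (concat F)) (length-map g (concat G)) ⟩
    length (concat F) + length (concat G)          ∎
    where open ≡-Reasoning

  lengths-glue : (F : List (List A)) (G : List (List B)) →
    map length (glue F G) ≡ map length F ++ map length G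
  lengths-glue F G = begin
    map length (map (map f) F ++ map (map g) G)                 ≡⟨ map-++ length (map (map f) F) _ ⟩
    map length (map (map f) F) ++ map length (map (map g) G)   ≡⟨ cong₂ _++_ (sym (map-∘ F)) (sym (map-∘ G)) ⟩
    map (length ∘ map f) F ++ map (length ∘ map g) G           ≡⟨ cong₂ _++_ (map-cong (length-map f) F) (map-cong (length-map g) G) ⟩
    map length F ++ map length G                               ∎
    where open ≡-Reasoning

  All-length-glue : {P : ℕ → Set} {F : List (List A)} {G : List (List B)} →
    All (P ∘ length) F → All (P ∘ length) G → All (P ∘ length) (glue F G)
  All-length-glue {P} PF PG = All.++⁺
    (All.map⁺ (All.map (λ {c} → subst P (sym (length-map f c))) PF))
    (All.map⁺ (All.map (λ {c} → subst P (sym (length-map g c))) PG))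

  All-arcs-glue : {R : C → C → Set} {R₁ : A → A → Set} {R₂ : B → B → Set} {F : List (List A)} {G : List (List B)} →
    (∀ {x y} → R₁ x y → R (f x) (f y)) → (∀ {x y} → R₂ x y → R (g x) (g y)) →
    All (uncurry R₁) (concat (map cycleArcs F)) → All (uncurry R₂) (concat (map cycleArcs G)) →
    All (uncurry R) (concat (map cycleArcs (glue F G)))
  All-arcs-glue {R} {F = F} {G} f-hom g-hom RF RG = subst (All (uncurry R)) (sym (arcs-glue F G))
    (All.++⁺ (All.map⁺ (All.map f-hom RF)) (All.map⁺ (All.map g-hom RG)))

  ∈-arcs-glue⁻ : {F : List (List A)} {G : List (List B)} {p : C × C} → p ∈ concat (map cycleArcs (glue F G)) →
    (∃ λ a → a ∈ concat (map cycleArcs F) × p ≡ mapArc f a) ⊎ (∃ λ b → b ∈ concat (map cycleArcs G) × p ≡ mapArc g b)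
  ∈-arcs-glue⁻ {F} {G} p∈ = ⊎.map (∈-map⁻ (mapArc f)) (∈-map⁻ (mapArc g))
    (∈-++⁻ (map (mapArc f) (concat (map cycleArcs F))) (subst (_ ∈_) (arcs-glue F G) p∈))

  ∈-arcs-glue⁺ˡ : {F : List (List A)} (G : List (List B)) {a : A × A} →
    a ∈ concat (map cycleArcs F) → mapArc f a ∈ concat (map cycleArcs (glue F G))
  ∈-arcs-glue⁺ˡ {F} G a∈ = subst (_ ∈_) (sym (arcs-glue F G)) (∈-++⁺ˡ (∈-map⁺ (mapArc f) a∈))

  ∈-arcs-glue⁺ʳ : (F : List (List A)) {G : List (List B)} {b : B × B} →
    b ∈ concat (map cycleArcs G) → mapArc g b ∈ concat (map cycleArcs (glue F G))
  ∈-arcs-glue⁺ʳ F {G} b∈ = subst (_ ∈_) (sym (arcs-glue F G)) (∈-++⁺ʳ _ (∈-map⁺ (mapArc g) b∈))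

  ∈-++-mapˡ : Injective _≡_ _≡_ f → {a : A} → (∀ b → f a ≢ g b) →
    {xs : List A} {ys : List B} → f a ∈ map f xs ++ map g ys ⇔ a ∈ xs
  ∈-++-mapˡ f-inj f≢g {xs} = mk⇔ to (∈-++⁺ˡ ∘ ∈-map⁺ f)
    where
    to : f _ ∈ map f xs ++ map g _ → _ ∈ xs
    to fa∈ with ∈-++⁻ (map f xs) fa∈
    ... | inj₁ fa∈f = let a′ , a′∈ , eq = ∈-map⁻ f fa∈f in subst (_∈ xs) (sym (f-inj eq)) a′∈
    ... | inj₂ fa∈g = let b , _ , eq = ∈-map⁻ g fa∈g in ⊥-elim (f≢g b eq)

  ∈-++-mapʳ : Injective _≡_ _≡_ g → {b : B} → (∀ a → f a ≢ g b) →
    {xs : List A} {ys : List B} → g b ∈ map f xs ++ map g ys ⇔ b ∈ ys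
  ∈-++-mapʳ g-inj f≢g {xs} {ys} = mk⇔ to (∈-++⁺ʳ (map f xs) ∘ ∈-map⁺ g)
    where
    to : g _ ∈ map f xs ++ map g ys → _ ∈ ys
    to gb∈ with ∈-++⁻ (map f xs) gb∈
    ... | inj₁ gb∈f = let a , _ , eq = ∈-map⁻ f gb∈f in ⊥-elim (f≢g a (sym eq))
    ... | inj₂ gb∈g = let b′ , b′∈ , eq = ∈-map⁻ g gb∈g in subst (_∈ ys) (sym (g-inj eq)) b′∈

mapArc-injective : {A B : Set} {f : A → B} → Injective _≡_ _≡_ f → Injective _≡_ _≡_ (mapArc f)
mapArc-injective f-inj eq = cong₂ _,_ (f-inj (cong proj₁ eq)) (f-inj (cong proj₂ eq))

module _ {A : Set} {a b : A} {V : List A} where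

  ExactlyOne-resp-⇔ : {B : Set} {a′ b′ : B} {W : List B} →
    a ∈ V ⇔ a′ ∈ W → b ∈ V ⇔ b′ ∈ W → ExactlyOne a′ b′ W → ExactlyOne a b V
  ExactlyOne-resp-⇔ a⇔ b⇔ (inj₁ (a′∈ , b′∉)) = inj₁ (Equivalence.from a⇔ a′∈ , b′∉ ∘ Equivalence.to b⇔)
  ExactlyOne-resp-⇔ a⇔ b⇔ (inj₂ (a′∉ , b′∈)) = inj₂ (a′∉ ∘ Equivalence.to a⇔ , Equivalence.from b⇔ b′∈)

  ExactlyOne-not-both : ExactlyOne a b V → a ∈ V → b ∈ V → ⊥
  ExactlyOne-not-both (inj₁ (_ , b∉)) _ b∈ = b∉ b∈
  ExactlyOne-not-both (inj₂ (a∉ , _)) a∈ _ = a∉ a∈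

side : {ℓ : ℕ} → Vertex ℓ → Side
side = proj₁

index : {ℓ : ℕ} → Vertex ℓ → ℕ
index = toℕ ∘ proj₂

vertex-≡ : {ℓ : ℕ} {u v : Vertex ℓ} → side u ≡ side v → index u ≡ index v → u ≡ v
vertex-≡ refl eq = cong (_ ,_) (toℕ-injective eq)

partner : (ℓ : ℕ) → Ext → Vertex ℓ
partner ℓ ex0 = xℓ ℓ
partner ℓ ex1 = xℓ₁ ℓ
partner ℓ ey0 = yℓ ℓ
partner ℓ ey1 = yℓ₁ ℓ

admissible : {ℓ : ℕ} {ms : List ℕ} {C : Cycles ℓ} → AdmissibleCopy ℓ ms C →
  (e : Ext) → ExactlyOne (ext ℓ e) (partner ℓ e) (verts C)
admissible A ex0 = AdmissibleCopy.adm-x0 A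
admissible A ex1 = AdmissibleCopy.adm-x1 A
admissible A ey0 = AdmissibleCopy.adm-y0 A
admissible A ey1 = AdmissibleCopy.adm-y1 A

module _ {ℓ ℓ′ : ℕ} where

  side-partner : (e : Ext) → side (partner ℓ e) ≡ side (ext ℓ′ e)
  side-partner ex0 = refl
  side-partner ex1 = refl
  side-partner ey0 = refl
  side-partner ey1 = refl

  index-partner : (e : Ext) → index (partner ℓ e) ≡ ℓ + index (ext ℓ′ e)
  index-partner ex0 = trans (toℕ-inject₁ _) (trans (toℕ-fromℕ ℓ) (sym (+-identityʳ ℓ)))
  index-partner ex1 = trans (toℕ-fromℕ (suc ℓ)) (+-comm 1 ℓ)
  index-partner ey0 = trans (toℕ-inject₁ _) (trans (toℕ-fromℕ ℓ) (sym (+-identityʳ ℓ)))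
  index-partner ey1 = trans (toℕ-fromℕ (suc ℓ)) (+-comm 1 ℓ)

index-ext<2 : {ℓ : ℕ} (e : Ext) → index (ext ℓ e) < 2
index-ext<2 ex0 = s≤s z≤n
index-ext<2 ex1 = s≤s (s≤s z≤n)
index-ext<2 ey0 = s≤s z≤n
index-ext<2 ey1 = s≤s (s≤s z≤n)

index<2⇒ext : {ℓ : ℕ} (v : Vertex ℓ) → index v < 2 → ∃ λ e → v ≡ ext ℓ e
index<2⇒ext (X , fz)          _ = ex0 , refl
index<2⇒ext (X , fs fz)       _ = ex1 , refl
index<2⇒ext (Y , fz)          _ = ey0 , refl
index<2⇒ext (Y , fs fz)       _ = ey1 , refl
index<2⇒ext (_ , fs (fs _)) (s≤s (s≤s ()))

ext≢partner : {ℓ : ℕ} → 2 ≤ ℓ → (e e′ : Ext) → ext ℓ e ≢ partner ℓ e′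
ext≢partner {ℓ} 2≤ℓ e e′ eq = <⇒≱ (index-ext<2 e) (begin
  2                          ≤⟨ 2≤ℓ ⟩
  ℓ                          ≤⟨ m≤m+n ℓ _ ⟩
  ℓ + index (ext ℓ e′)       ≡⟨ sym (index-partner e′) ⟩
  index (partner ℓ e′)       ≡⟨ cong index eq ⟨
  index (ext ℓ e)            ∎)
  where open ≤-Reasoning

m+[2+n]≡2+[m+n] : ∀ m n → m + (2 + n) ≡ 2 + (m + n)
m+[2+n]≡2+[m+n] m n = trans (+-suc m (suc n)) (cong suc (+-suc m n))

-- Adj on sides and numeric indices, where embedding into a longer J and cutting at an index are arithmetic.
data Adjℕ (ℓ : ℕ) : Side → Side → ℕ → ℕ → Set where
  rung  : ∀ {a} → 1 ≤ a → a ≤ ℓ → Adjℕ ℓ X Y a a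
  step1 : ∀ s t {a} → a < ℓ → Adjℕ ℓ s t a (1 + a)
  step2 : ∀ s t {a} → a < ℓ → Adjℕ ℓ s t a (2 + a)

Adj⇒Adjℕ : {ℓ : ℕ} {u v : Vertex ℓ} → Adj ℓ u v → Adjℕ ℓ (side u) (side v) (index u) (index v)
Adj⇒Adjℕ (rung _ 1≤i i≤ℓ)    = rung 1≤i i≤ℓ
Adj⇒Adjℕ (step1 s t _ _ i<ℓ j≡) = subst (Adjℕ _ s t _) (sym j≡) (step1 s t i<ℓ)
Adj⇒Adjℕ (step2 s t _ _ i<ℓ j≡) = subst (Adjℕ _ s t _) (sym j≡) (step2 s t i<ℓ)

Adjℕ⇒Adj : {ℓ a b : ℕ} {s t : Side} {i j : Fin (2 + ℓ)} →
  Adjℕ ℓ s t a b → toℕ i ≡ a → toℕ j ≡ b → Adj ℓ (s , i) (t , j)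
Adjℕ⇒Adj {i = i} (rung 1≤a a≤ℓ) refl j≡ with toℕ-injective {i = i} (sym j≡)
... | refl = rung i 1≤a a≤ℓ
Adjℕ⇒Adj (step1 s t a<ℓ) refl j≡ = step1 s t _ _ a<ℓ j≡
Adjℕ⇒Adj (step2 s t a<ℓ) refl j≡ = step2 s t _ _ a<ℓ j≡

Adjℕ-bounded : {ℓ a b : ℕ} {s t : Side} → Adjℕ ℓ s t a b → a < 2 + ℓ × b < 2 + ℓ
Adjℕ-bounded (rung _ a≤ℓ)    = s≤s (m≤n⇒m≤1+n a≤ℓ) , s≤s (m≤n⇒m≤1+n a≤ℓ)
Adjℕ-bounded (step1 _ _ a<ℓ) = m<n⇒m<1+n (m<n⇒m<1+n a<ℓ) , s≤s (s≤s (<⇒≤ a<ℓ))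
Adjℕ-bounded (step2 _ _ a<ℓ) = m<n⇒m<1+n (m<n⇒m<1+n a<ℓ) , s≤s (s≤s a<ℓ)

Adjℕ-weaken : {ℓ ℓ′ a b : ℕ} {s t : Side} → ℓ ≤ ℓ′ → Adjℕ ℓ s t a b → Adjℕ ℓ′ s t a b
Adjℕ-weaken ℓ≤ℓ′ (rung 1≤a a≤ℓ)  = rung 1≤a (≤-trans a≤ℓ ℓ≤ℓ′)
Adjℕ-weaken ℓ≤ℓ′ (step1 s t a<ℓ) = step1 s t (<-≤-trans a<ℓ ℓ≤ℓ′)
Adjℕ-weaken ℓ≤ℓ′ (step2 s t a<ℓ) = step2 s t (<-≤-trans a<ℓ ℓ≤ℓ′)

Adjℕ-suc : {ℓ a b : ℕ} {s t : Side} → Adjℕ ℓ s t a b → Adjℕ (suc ℓ) s t (suc a) (suc b)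
Adjℕ-suc (rung _ a≤ℓ)    = rung (s≤s z≤n) (s≤s a≤ℓ)
Adjℕ-suc (step1 s t a<ℓ) = step1 s t (s<s a<ℓ)
Adjℕ-suc (step2 s t a<ℓ) = step2 s t (s<s a<ℓ)

Adjℕ-shift : (k : ℕ) {ℓ a b : ℕ} {s t : Side} → Adjℕ ℓ s t a b → Adjℕ (k + ℓ) s t (k + a) (k + b)
Adjℕ-shift zero    adj = adj
Adjℕ-shift (suc k) adj = Adjℕ-suc (Adjℕ-shift k adj)

data Offset (k : ℕ) : ℕ → Set where
  below : ∀ {a} → a < k → Offset k a
  above : ∀ a → Offset k (k + a)

offset : (k a : ℕ) → Offset k a
offset zero    a       = above a
offset (suc k) zero    = below z<s
offset (suc k) (suc a) with offset k a
... | below a<k = below (s<s a<k)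
... | above a′  = above a′

Adjℕ-split : (k : ℕ) {ℓ a b : ℕ} {s t : Side} → Adjℕ (k + ℓ) s t a b →
  Adjℕ k s t a b ⊎ ∃₂ λ a′ b′ → a ≡ k + a′ × b ≡ k + b′ × Adjℕ ℓ s t a′ b′
Adjℕ-split k (rung {a} 1≤a a≤) with offset k a
... | below a<k      = inj₁ (rung 1≤a (<⇒≤ a<k))
... | above zero     = inj₁ (rung 1≤a (≤-reflexive (+-identityʳ k)))
... | above (suc a′) = inj₂ (_ , _ , refl , refl , rung (s≤s z≤n) (+-cancelˡ-≤ k _ _ a≤))
Adjℕ-split k (step1 s t {a} a<) with offset k a
... | below a<k = inj₁ (step1 s t a<k)
... | above a′  = inj₂ (_ , _ , refl , sym (+-suc k a′) , step1 s t (+-cancelˡ-< k _ _ a<))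
Adjℕ-split k (step2 s t {a} a<) with offset k a
... | below a<k = inj₁ (step2 s t a<k)
... | above a′  = inj₂ (_ , _ , refl , sym (m+[2+n]≡2+[m+n] k a′) , step2 s t (+-cancelˡ-< k _ _ a<))

Adjℕ-beyond : {ℓ a b : ℕ} {s t : Side} → Adjℕ ℓ s t a b → ℓ ≤ a → a ≡ ℓ × b ≡ ℓ
Adjℕ-beyond (rung _ a≤ℓ)    ℓ≤a = ≤-antisym a≤ℓ ℓ≤a , ≤-antisym a≤ℓ ℓ≤a
Adjℕ-beyond (step1 _ _ a<ℓ) ℓ≤a = ⊥-elim (<⇒≱ a<ℓ ℓ≤a)
Adjℕ-beyond (step2 _ _ a<ℓ) ℓ≤a = ⊥-elim (<⇒≱ a<ℓ ℓ≤a)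

Adjℕ-irreflexive-at-0 : {ℓ : ℕ} {s t : Side} → ¬ Adjℕ ℓ s t 0 0
Adjℕ-irreflexive-at-0 (rung () _)

module _ {ℓ : ℕ} {u v : Vertex ℓ} where

  JArc-beyond : JArc ℓ u v → ℓ ≤ index u → ℓ ≤ index v → index u ≡ ℓ × index v ≡ ℓ
  JArc-beyond (inj₁ adj) ℓ≤u _ = Adjℕ-beyond (Adj⇒Adjℕ adj) ℓ≤u
  JArc-beyond (inj₂ adj) _ ℓ≤v = ×.swap (Adjℕ-beyond (Adj⇒Adjℕ adj) ℓ≤v)

  JArc-within-index-0 : JArc ℓ u v → index u ≡ 0 → index v ≡ 0 → ⊥
  JArc-within-index-0 (inj₁ adj) u≡0 v≡0 = Adjℕ-irreflexive-at-0 (subst₂ (Adjℕ ℓ _ _) u≡0 v≡0 (Adj⇒Adjℕ adj))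
  JArc-within-index-0 (inj₂ adj) u≡0 v≡0 = Adjℕ-irreflexive-at-0 (subst₂ (Adjℕ ℓ _ _) v≡0 u≡0 (Adj⇒Adjℕ adj))

no-three-distinct-in-pair : {A : Set} {a b c : A} (V : List A) → length V ≡ 2 →
  a ∈ V → b ∈ V → c ∈ V → a ≢ b → a ≢ c → b ≢ c → ⊥
no-three-distinct-in-pair (_ ∷ _ ∷ []) refl a∈ b∈ c∈ a≢b a≢c b≢c with a∈ | b∈ | c∈
... | here refl         | here refl         | _                 = a≢b refl
... | there (here refl) | there (here refl) | _                 = a≢b refl
... | here refl         | there (here refl) | here refl         = a≢c refl
... | here refl         | there (here refl) | there (here refl) = b≢c refl
... | there (here refl) | here refl         | here refl         = b≢c refl
... | there (here refl) | here refl         | there (here refl) = a≢c refl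

-- A copy in J*₂ has only two vertices, yet the one containing the arc x₀x₁ must also contain y₀ or y₁.
no-admissible-decomposition-of-J₂ : {ms : List ℕ} → ¬ AdmissibleDecomp 1 ms
no-admissible-decomposition-of-J₂ D = ⊎.[ no-y ∘ proj₁ , no-y ∘ proj₂ ] (admissible (copy i) ey0)
  where
  open AdmissibleDecomp D
  open AdmissibleCopy
  x₀x₁-covered : ∃ λ i → (x₀ 1 , x₁ 1) ∈ arcs (F i)
  x₀x₁-covered = arcCover (x₀ 1) (x₁ 1) (inj₁ (step1 X X fz (fs fz) z<s refl))
  i : Fin 9
  i = proj₁ x₀x₁-covered
  no-y : ∀ {j} → (Y , j) ∈ verts (F i) → ⊥
  no-y y∈ = let x₀∈ , x₁∈ = ∈-arcs⁻ (F i) (proj₂ x₀x₁-covered) in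
    no-three-distinct-in-pair _ (order (copy i)) x₀∈ x₁∈ y∈ (λ ()) (λ ()) (λ ())

Image₂ : {A B : Set} → (A → A → Set) → (A → B) → B → B → Set
Image₂ R f u v = ∃₂ λ u′ v′ → R u′ v′ × f u′ ≡ u × f v′ ≡ v

module _ {A B : Set} {R : A → A → Set} {f : A → B} {u v : B} where

  Image₂-map : {R′ : A → A → Set} → (∀ {x y} → R x y → R′ x y) → Image₂ R f u v → Image₂ R′ f u v
  Image₂-map R⇒R′ (u′ , v′ , r , fu′ , fv′) = u′ , v′ , R⇒R′ r , fu′ , fv′

  Image₂-flip : Image₂ R f v u → Image₂ (flip R) f u v
  Image₂-flip (v′ , u′ , r , fv′ , fu′) = u′ , v′ , r , fu′ , fv′

module Embedding (ℓ₁ ℓ₂ : ℕ) where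

  ι₁ : Vertex ℓ₁ → Vertex (ℓ₁ + ℓ₂)
  ι₁ (s , i) = s , i ↑ˡ ℓ₂

  ι₂ : Vertex ℓ₂ → Vertex (ℓ₁ + ℓ₂)
  ι₂ (s , j) = s , cast (m+[2+n]≡2+[m+n] ℓ₁ ℓ₂) (ℓ₁ ↑ʳ j)

  index-ι₁ : (u : Vertex ℓ₁) → index (ι₁ u) ≡ index u
  index-ι₁ (_ , i) = toℕ-↑ˡ i ℓ₂

  index-ι₂ : (v : Vertex ℓ₂) → index (ι₂ v) ≡ ℓ₁ + index v
  index-ι₂ (_ , j) = trans (toℕ-cast _ (ℓ₁ ↑ʳ j)) (toℕ-↑ʳ ℓ₁ j)

  ι₁-injective : Injective _≡_ _≡_ ι₁
  ι₁-injective {u} {v} eq = vertex-≡ (cong side eq) (trans (sym (index-ι₁ u)) (trans (cong index eq) (index-ι₁ v)))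

  ι₂-injective : Injective _≡_ _≡_ ι₂
  ι₂-injective {u} {v} eq = vertex-≡ (cong side eq)
    (+-cancelˡ-≡ ℓ₁ _ _ (trans (sym (index-ι₂ u)) (trans (cong index eq) (index-ι₂ v))))

  ι₁≡ι₂⇒index : {u : Vertex ℓ₁} {v : Vertex ℓ₂} → ι₁ u ≡ ι₂ v → index u ≡ ℓ₁ + index v
  ι₁≡ι₂⇒index {u} {v} eq = trans (sym (index-ι₁ u)) (trans (cong index eq) (index-ι₂ v))

  seam : {u : Vertex ℓ₁} {v : Vertex ℓ₂} → ι₁ u ≡ ι₂ v → ∃ λ e → u ≡ partner ℓ₁ e × v ≡ ext ℓ₂ e
  seam {u} {v} eq = e , vertex-≡ side-u index-u , v≡e
    where
    index-v<2 : index v < 2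
    index-v<2 = +-cancelˡ-< ℓ₁ _ 2 (subst₂ _<_ (ι₁≡ι₂⇒index eq) (+-comm 2 ℓ₁) (toℕ<n (proj₂ u)))
    e : Ext
    e = proj₁ (index<2⇒ext v index-v<2)
    v≡e : v ≡ ext ℓ₂ e
    v≡e = proj₂ (index<2⇒ext v index-v<2)
    side-u : side u ≡ side (partner ℓ₁ e)
    side-u = trans (cong side eq) (trans (cong side v≡e) (sym (side-partner e)))
    index-u : index u ≡ index (partner ℓ₁ e)
    index-u = trans (ι₁≡ι₂⇒index eq) (trans (cong (λ w → ℓ₁ + index w) v≡e) (sym (index-partner e)))

  JArc-ι₁ : {u v : Vertex ℓ₁} → JArc ℓ₁ u v → JArc (ℓ₁ + ℓ₂) (ι₁ u) (ι₁ v)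
  JArc-ι₁ = ⊎.map Adj-ι₁ Adj-ι₁
    where
    Adj-ι₁ : {u v : Vertex ℓ₁} → Adj ℓ₁ u v → Adj (ℓ₁ + ℓ₂) (ι₁ u) (ι₁ v)
    Adj-ι₁ {u} {v} adj = Adjℕ⇒Adj (Adjℕ-weaken (m≤m+n ℓ₁ ℓ₂) (Adj⇒Adjℕ adj)) (index-ι₁ u) (index-ι₁ v)

  JArc-ι₂ : {u v : Vertex ℓ₂} → JArc ℓ₂ u v → JArc (ℓ₁ + ℓ₂) (ι₂ u) (ι₂ v)
  JArc-ι₂ = ⊎.map Adj-ι₂ Adj-ι₂
    where
    Adj-ι₂ : {u v : Vertex ℓ₂} → Adj ℓ₂ u v → Adj (ℓ₁ + ℓ₂) (ι₂ u) (ι₂ v)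
    Adj-ι₂ {u} {v} adj = Adjℕ⇒Adj (Adjℕ-shift ℓ₁ (Adj⇒Adjℕ adj)) (index-ι₂ u) (index-ι₂ v)

  ι₁-fromℕ< : {s : Side} {i : Fin (2 + (ℓ₁ + ℓ₂))} (i< : toℕ i < 2 + ℓ₁) → ι₁ (s , fromℕ< i<) ≡ (s , i)
  ι₁-fromℕ< {s} i< = vertex-≡ refl (trans (index-ι₁ (s , fromℕ< i<)) (toℕ-fromℕ< i<))

  ι₂-fromℕ< : {s : Side} {i : Fin (2 + (ℓ₁ + ℓ₂))} {a : ℕ} → toℕ i ≡ ℓ₁ + a →
    (a< : a < 2 + ℓ₂) → ι₂ (s , fromℕ< a<) ≡ (s , i)
  ι₂-fromℕ< {s} i≡ a< = vertex-≡ refl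
    (trans (index-ι₂ (s , fromℕ< a<)) (trans (cong (ℓ₁ +_) (toℕ-fromℕ< a<)) (sym i≡)))

  Adj-split : {u v : Vertex (ℓ₁ + ℓ₂)} → Adj (ℓ₁ + ℓ₂) u v → Image₂ (Adj ℓ₁) ι₁ u v ⊎ Image₂ (Adj ℓ₂) ι₂ u v
  Adj-split {s , i} {t , j} adj with Adjℕ-split ℓ₁ (Adj⇒Adjℕ adj)
  ... | inj₁ adj₁ = let i< , j< = Adjℕ-bounded adj₁ in
    inj₁ (_ , _ , Adjℕ⇒Adj adj₁ (toℕ-fromℕ< i<) (toℕ-fromℕ< j<) , ι₁-fromℕ< i< , ι₁-fromℕ< j<)
  ... | inj₂ (_ , _ , i≡ , j≡ , adj₂) = let a< , b< = Adjℕ-bounded adj₂ in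
    inj₂ (_ , _ , Adjℕ⇒Adj adj₂ (toℕ-fromℕ< a<) (toℕ-fromℕ< b<) , ι₂-fromℕ< i≡ a< , ι₂-fromℕ< j≡ b<)

  JArc-split : {u v : Vertex (ℓ₁ + ℓ₂)} → JArc (ℓ₁ + ℓ₂) u v → Image₂ (JArc ℓ₁) ι₁ u v ⊎ Image₂ (JArc ℓ₂) ι₂ u v
  JArc-split (inj₁ adj) = ⊎.map (Image₂-map inj₁) (Image₂-map inj₁) (Adj-split adj)
  JArc-split (inj₂ adj) = ⊎.map (Image₂-map inj₂ ∘ Image₂-flip) (Image₂-map inj₂ ∘ Image₂-flip) (Adj-split adj)

  -- Shared endpoints have index ≥ ℓ₁ in J_{2ℓ₁}, so the arc is the rung at ℓ₁; in J_{2ℓ₂} it would join two vertices of index 0.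
  no-shared-arc : {u v : Vertex ℓ₁} {u′ v′ : Vertex ℓ₂} →
    JArc ℓ₁ u v → JArc ℓ₂ u′ v′ → ι₁ u ≡ ι₂ u′ → ι₁ v ≡ ι₂ v′ → ⊥
  no-shared-arc {u} {v} {u′} {v′} arc₁ arc₂ u≡ v≡ =
    JArc-within-index-0 arc₂ (index-0 u≡ (proj₁ at-ℓ₁)) (index-0 v≡ (proj₂ at-ℓ₁))
    where
    ℓ₁≤ : {w : Vertex ℓ₁} {w′ : Vertex ℓ₂} → ι₁ w ≡ ι₂ w′ → ℓ₁ ≤ index w
    ℓ₁≤ eq = subst (ℓ₁ ≤_) (sym (ι₁≡ι₂⇒index eq)) (m≤m+n ℓ₁ _)
    at-ℓ₁ : index u ≡ ℓ₁ × index v ≡ ℓ₁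
    at-ℓ₁ = JArc-beyond arc₁ (ℓ₁≤ u≡) (ℓ₁≤ v≡)
    index-0 : {w : Vertex ℓ₁} {w′ : Vertex ℓ₂} → ι₁ w ≡ ι₂ w′ → index w ≡ ℓ₁ → index w′ ≡ 0
    index-0 eq w≡ℓ₁ = +-cancelˡ-≡ ℓ₁ _ 0 (trans (sym (ι₁≡ι₂⇒index eq)) (trans w≡ℓ₁ (sym (+-identityʳ ℓ₁))))

  ι₁-ext : (e : Ext) → ι₁ (ext ℓ₁ e) ≡ ext (ℓ₁ + ℓ₂) e
  ι₁-ext ex0 = refl
  ι₁-ext ex1 = refl
  ι₁-ext ey0 = refl
  ι₁-ext ey1 = refl

  ι₂-partner : (e : Ext) → ι₂ (partner ℓ₂ e) ≡ partner (ℓ₁ + ℓ₂) e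
  ι₂-partner e = vertex-≡ (trans (side-partner {ℓ₂} {ℓ₂} e) (sym (side-partner {ℓ₁ + ℓ₂} e))) (begin
    index (ι₂ (partner ℓ₂ e))      ≡⟨ index-ι₂ (partner ℓ₂ e) ⟩
    ℓ₁ + index (partner ℓ₂ e)      ≡⟨ cong (ℓ₁ +_) (index-partner e) ⟩
    ℓ₁ + (ℓ₂ + index (ext ℓ₂ e))   ≡⟨ +-assoc ℓ₁ ℓ₂ _ ⟨
    ℓ₁ + ℓ₂ + index (ext ℓ₂ e)     ≡⟨ index-partner e ⟨
    index (partner (ℓ₁ + ℓ₂) e)    ∎)
    where open ≡-Reasoning

Compatible : {ℓ₁ ℓ₂ : ℕ} {ms rs : List ℕ} → AdmissibleDecomp ℓ₁ ms → AdmissibleDecomp ℓ₂ rs → Set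
Compatible {ℓ₁} {ℓ₂} D₁ D₂ = (i : Fin 9) (e : Ext) →
  ext ℓ₁ e ∈ verts (AdmissibleDecomp.F D₁ i) ⇔ ext ℓ₂ e ∈ verts (AdmissibleDecomp.F D₂ i)

same-pattern⇒compatible : {ℓ₁ ℓ₂ : ℕ} {ms rs : List ℕ} {P : Fin 9 → Ext → Bool}
  (D₁ : AdmissibleDecomp ℓ₁ ms) (D₂ : AdmissibleDecomp ℓ₂ rs) → HasPattern D₁ P → HasPattern D₂ P → Compatible D₁ D₂
same-pattern⇒compatible _ _ H₁ H₂ i e = ⇔-sym (H₂ i e) ⇔-∘ H₁ i e

module Gluing {ℓ₁ ℓ₂ : ℕ} (2≤ℓ₁ : 2 ≤ ℓ₁) (2≤ℓ₂ : 2 ≤ ℓ₂) where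
  open Embedding ℓ₁ ℓ₂

  glued : Cycles ℓ₁ → Cycles ℓ₂ → Cycles (ℓ₁ + ℓ₂)
  glued = glue ι₁ ι₂

  module _ {C₁ : Cycles ℓ₁} {C₂ : Cycles ℓ₂} (e : Ext) where

    ext-∈-glued : ext (ℓ₁ + ℓ₂) e ∈ verts (glued C₁ C₂) ⇔ ext ℓ₁ e ∈ verts C₁
    ext-∈-glued rewrite concat-glue ι₁ ι₂ C₁ C₂ | sym (ι₁-ext e) =
      ∈-++-mapˡ ι₁ ι₂ ι₁-injective λ _ eq → ext≢partner 2≤ℓ₁ e _ (proj₁ (proj₂ (seam eq)))

    partner-∈-glued : partner (ℓ₁ + ℓ₂) e ∈ verts (glued C₁ C₂) ⇔ partner ℓ₂ e ∈ verts C₂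
    partner-∈-glued rewrite concat-glue ι₁ ι₂ C₁ C₂ | sym (ι₂-partner e) =
      ∈-++-mapʳ ι₁ ι₂ ι₂-injective λ _ eq → ext≢partner 2≤ℓ₂ _ e (sym (proj₂ (proj₂ (seam eq))))

  glued-copy : {ms rs : List ℕ} {C₁ : Cycles ℓ₁} {C₂ : Cycles ℓ₂} →
    AdmissibleCopy ℓ₁ ms C₁ → AdmissibleCopy ℓ₂ rs C₂ →
    ((e : Ext) → ext ℓ₁ e ∈ verts C₁ ⇔ ext ℓ₂ e ∈ verts C₂) →
    AdmissibleCopy (ℓ₁ + ℓ₂) (ms ++ rs) (glued C₁ C₂)
  glued-copy {ms} {rs} {C₁} {C₂} A₁ A₂ compatible = record
    { cycleLengths = subst (_↭ ms ++ rs) (sym (lengths-glue ι₁ ι₂ C₁ C₂))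
                       (↭.++⁺ (cycleLengths A₁) (cycleLengths A₂))
    ; cyclesLong   = All-length-glue ι₁ ι₂ {P = 2 ≤_} (cyclesLong A₁) (cyclesLong A₂)
    ; disjoint     = subst Unique (sym (concat-glue ι₁ ι₂ C₁ C₂))
                       (Unique.++⁺ (Unique.map⁺ ι₁-injective (disjoint A₁)) (Unique.map⁺ ι₂-injective (disjoint A₂))
                                   images-disjoint)
    ; arcsInJ      = All-arcs-glue ι₁ ι₂ {R = JArc (ℓ₁ + ℓ₂)} {F = C₁} {G = C₂} JArc-ι₁ JArc-ι₂ (arcsInJ A₁) (arcsInJ A₂)
    ; order        = begin
        length (verts (glued C₁ C₂))          ≡⟨ length-concat-glue ι₁ ι₂ C₁ C₂ ⟩
        length (verts C₁) + length (verts C₂) ≡⟨ cong₂ _+_ (order A₁) (order A₂) ⟩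
        2 * ℓ₁ + 2 * ℓ₂                       ≡⟨ *-distribˡ-+ 2 ℓ₁ ℓ₂ ⟨
        2 * (ℓ₁ + ℓ₂)                         ∎
    ; adm-x0       = adm ex0
    ; adm-x1       = adm ex1
    ; adm-y0       = adm ey0
    ; adm-y1       = adm ey1
    }
    where
    open AdmissibleCopy
    open ≡-Reasoning
    images-disjoint : Disjoint (map ι₁ (verts C₁)) (map ι₂ (verts C₂))
    images-disjoint (w∈₁ , w∈₂) with ∈-map⁻ ι₁ w∈₁ | ∈-map⁻ ι₂ w∈₂
    ... | u , u∈ , refl | v , v∈ , u≡v with seam u≡v
    ...   | e , refl , refl = ExactlyOne-not-both (admissible A₁ e) (Equivalence.from (compatible e) v∈) u∈
    adm : (e : Ext) → ExactlyOne (ext (ℓ₁ + ℓ₂) e) (partner (ℓ₁ + ℓ₂) e) (verts (glued C₁ C₂))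
    adm e = ExactlyOne-resp-⇔ (compatible e ⇔-∘ ext-∈-glued {C₁} e) (partner-∈-glued {C₁} e) (admissible A₂ e)

  glued-decomposition : {ms rs : List ℕ} (D₁ : AdmissibleDecomp ℓ₁ ms) (D₂ : AdmissibleDecomp ℓ₂ rs) →
    Compatible D₁ D₂ → AdmissibleDecomp (ℓ₁ + ℓ₂) (ms ++ rs)
  glued-decomposition D₁ D₂ compatible = record
    { F        = F
    ; copy     = λ i → glued-copy {C₁ = D₁.F i} {D₂.F i} (D₁.copy i) (D₂.copy i) (compatible i)
    ; arcDisj  = arcDisj
    ; arcCover = arcCover
    }
    where
    module D₁ = AdmissibleDecomp D₁
    module D₂ = AdmissibleDecomp D₂
    F : Fin 9 → Cycles (ℓ₁ + ℓ₂)
    F i = glued (D₁.F i) (D₂.F i)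
    arcsInJ₁ : ∀ i {a} → a ∈ arcs (D₁.F i) → JArc ℓ₁ (proj₁ a) (proj₂ a)
    arcsInJ₁ i = All.lookup (AdmissibleCopy.arcsInJ (D₁.copy i))
    arcsInJ₂ : ∀ i {b} → b ∈ arcs (D₂.F i) → JArc ℓ₂ (proj₁ b) (proj₂ b)
    arcsInJ₂ i = All.lookup (AdmissibleCopy.arcsInJ (D₂.copy i))
    arcDisj : (i j : Fin 9) (u v : Vertex (ℓ₁ + ℓ₂)) → (u , v) ∈ arcs (F i) → (u , v) ∈ arcs (F j) → i ≡ j
    arcDisj i j _ _ uv∈i uv∈j with ∈-arcs-glue⁻ ι₁ ι₂ {D₁.F i} {D₂.F i} uv∈i | ∈-arcs-glue⁻ ι₁ ι₂ {D₁.F j} {D₂.F j} uv∈j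
    ... | inj₁ (a , a∈ , refl) | inj₁ (a′ , a′∈ , eq) =
      D₁.arcDisj i j _ _ a∈ (subst (_∈ arcs (D₁.F j)) (sym (mapArc-injective ι₁-injective eq)) a′∈)
    ... | inj₂ (b , b∈ , refl) | inj₂ (b′ , b′∈ , eq) =
      D₂.arcDisj i j _ _ b∈ (subst (_∈ arcs (D₂.F j)) (sym (mapArc-injective ι₂-injective eq)) b′∈)
    ... | inj₁ (a , a∈ , refl) | inj₂ (b , b∈ , eq) =
      ⊥-elim (no-shared-arc (arcsInJ₁ i a∈) (arcsInJ₂ j b∈) (cong proj₁ eq) (cong proj₂ eq))
    ... | inj₂ (b , b∈ , refl) | inj₁ (a , a∈ , eq) =
      ⊥-elim (no-shared-arc (arcsInJ₁ j a∈) (arcsInJ₂ i b∈) (cong proj₁ (sym eq)) (cong proj₂ (sym eq)))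
    arcCover : (u v : Vertex (ℓ₁ + ℓ₂)) → JArc (ℓ₁ + ℓ₂) u v → ∃ λ i → (u , v) ∈ arcs (F i)
    arcCover _ _ uv with JArc-split uv
    ... | inj₁ (u′ , v′ , arc , refl , refl) = ×.map₂ (λ {i} → ∈-arcs-glue⁺ˡ ι₁ ι₂ {D₁.F i} (D₂.F i)) (D₁.arcCover u′ v′ arc)
    ... | inj₂ (u′ , v′ , arc , refl , refl) = ×.map₂ (λ {i} → ∈-arcs-glue⁺ʳ ι₁ ι₂ (D₁.F i) {D₂.F i}) (D₂.arcCover u′ v′ arc)

  glued-pattern : {ms rs : List ℕ} {P : Fin 9 → Ext → Bool}
    (D₁ : AdmissibleDecomp ℓ₁ ms) (D₂ : AdmissibleDecomp ℓ₂ rs) (compatible : Compatible D₁ D₂) →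
    HasPattern D₁ P → HasPattern (glued-decomposition D₁ D₂ compatible) P
  glued-pattern D₁ D₂ _ H₁ i e = H₁ i e ⇔-∘ ext-∈-glued {AdmissibleDecomp.F D₁ i} {AdmissibleDecomp.F D₂ i} e

lemma4p7 : (ℓ₁ ℓ₂ : ℕ) → 1 ≤ ℓ₁ → 1 ≤ ℓ₂ → (ms rs : List ℕ) (P : Fin 9 → Ext → Bool)
    → (D₁ : AdmissibleDecomp ℓ₁ ms) → (D₂ : AdmissibleDecomp ℓ₂ rs)
    → HasPattern D₁ P → HasPattern D₂ P
    → Σ (AdmissibleDecomp (ℓ₁ + ℓ₂) (ms ++ rs)) (λ D → HasPattern D P)
lemma4p7 _ _ 1≤ℓ₁ 1≤ℓ₂ _ _ _ D₁ D₂ H₁ H₂ with m≤n⇒m<n∨m≡n 1≤ℓ₁ | m≤n⇒m<n∨m≡n 1≤ℓ₂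
... | inj₂ refl | _         = ⊥-elim (no-admissible-decomposition-of-J₂ D₁)
... | inj₁ _    | inj₂ refl = ⊥-elim (no-admissible-decomposition-of-J₂ D₂)
... | inj₁ 2≤ℓ₁ | inj₁ 2≤ℓ₂ = glued-decomposition D₁ D₂ compatible , glued-pattern D₁ D₂ compatible H₁
  where
  open Gluing 2≤ℓ₁ 2≤ℓ₂
  compatible : Compatible D₁ D₂
  compatible = same-pattern⇒compatible D₁ D₂ H₁ H₂
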